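{- The canonical representations of the normal lattice operators $f, h$, of respective output types $1,\partial$, namely $\zeta_1(f(a_1,\ldots,a_n))=\overline{\alpha}_f(\zeta_1(a_1),\ldots,\zeta_1(a_n))$ (with $\zeta_\partial(f(\vec a))$ its Galois image) and $\zeta_\partial(h(a_1,\ldots,a_n))=\overline{\eta}_h(\zeta_\partial(a_1),\ldots,\zeta_\partial(a_n))$ (with $\zeta_1(h(\vec a))$ its Galois image), are the $\sigma$ and $\pi$-extension, respectively, of $f,h$.
   Context: Let $\mathcal{L}=(L,\leq,\wedge,\vee,0,1,f,h)$ be a bounded lattice with normal lattice operators $f$ of distribution type $(i_1,\ldots,i_n;1)$ and $h$ of type $(t_1,\ldots,t_n;\partial)$. Canonical frame: $X=Z_1$ the filters, $Y=Z_\partial$ the ideals of $\mathcal L$, $xIy$ iff $x\cap y\neq\emptyset$; Galois maps $U^\perp=\{y\mid\forall x\in U\,xIy\}$, ${}^\perp V=\{x\mid\forall y\in V\,xIy\}$; $\mathcal G(X),\mathcal G(Y)$ the stable/co-stable sets; $W'$ is $W^\perp$ or ${}^\perp W$ as sorted. Representation maps $\zeta_1(a)=\{x\in X\mid a\in x\}$, $\zeta_\partial(a)=\{y\in Y\mid a\in y\}=(\zeta_1(a))'$; $\mathcal G(X)$ with $\zeta_1$ is a canonical extension of the lattice (Gehrke–Harding), whose closed elements are the sets $\Gamma x$ (upsets of a filter $x$ under inclusion) and open elements the sets ${}^\perp\{y\}$. $\widehat f(\vec u)$ is the filter generated by $\{f(\vec a)\mid a_j\in u_j\}$, $\widehat h(\vec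 v)$ the ideal generated by $\{h(\vec a)\mid a_j\in v_j\}$; $xR\vec u$ iff $\widehat f(\vec u)\subseteq x$, $yS\vec v$ iff $\widehat h(\vec v)\subseteq y$. $\overline\alpha_R(\vec F)=(\bigcup_{\vec u\in\vec F}R\vec u)''$, $\overline\eta_S(\vec G)=(\bigcup_{\vec v\in\vec G}S\vec v)''$ on Galois sets; $\overline\alpha_f(A_1,\ldots,A_n)=\overline\alpha_R(\ldots,A_j,\ldots,A_r',\ldots)$ (using $A_j$ where $i_j=1$ and $A_r'$ where $i_r=\partial$), $A_j\in\mathcal G(X)$; $\overline\eta_h(B_1,\ldots,B_n)=\overline\eta_S(\ldots,B_r,\ldots,B_j',\ldots)$ (using $B_r$ where $t_r=\partial$ and $B_j'$ where $t_j=1$), $B_j\in\mathcal G(Y)$. For unary monotone $f$, the $\sigma$-extension is $f_\sigma(k)=\bigwedge\{f(a)\mid k\le a\in L\}$ for closed $k$ and $f_\sigma(u)=\bigvee\{f_\sigma(k)\mid k\text{ closed}, k\le u\}$; the $\pi$-extension is $f_\pi(o)=\bigvee\{f(a)\mid L\ni a\le o\}$ for open $o$ and $f_\pi(u)=\bigwedge\{f_\pi(o)\mid u\le o, o\text{ open}\}$ (with $L$ identified with its image), extended to $n$-ary operators of arbitrary distribution type in the standard way. -}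

module Defs where

open import Level using (Level; _⊔_; Lift) renaming (suc to lsuc)
open import Data.Nat using (ℕ; zero; suc)
open import Data.Fin using (Fin; zero; suc)
open import Data.Product using (Σ; ∃; _×_; proj₁)
open import Data.Vec.Functional using (updateAt)
open import Relation.Unary using (Pred; _⊆_; _≐_)
open import Relation.Binary.Lattice.Bundles using (BoundedLattice)

data Ty : Set where
  one ∂ : Ty

dual : Ty → Ty
dual one = ∂
dual ∂   = one

module Canonical {c ℓ₁ ℓ₂ : Level} (𝓛 : BoundedLattice c ℓ₁ ℓ₂) where
  open BoundedLattice 𝓛

  ℓ : Level
  ℓ = c ⊔ ℓ₁ ⊔ ℓ₂

  Op : ℕ → Set c
  Op n = (Fin n → Carrier) → Carrier

  _[_≔_] : ∀ {n} → (Fin n → Carrier) → Fin n → Carrier → (Fin n → Carrier)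
  a [ j ≔ b ] = updateAt a j (λ _ → b)

  meetF : ∀ m → (Fin m → Carrier) → Carrier
  meetF zero    g = ⊤
  meetF (suc m) g = g zero ∧ meetF m (λ k → g (suc k))

  joinF : ∀ m → (Fin m → Carrier) → Carrier
  joinF zero    g = ⊥
  joinF (suc m) g = g zero ∨ joinF m (λ k → g (suc k))

  PreservesOut1 : ∀ {n} → Ty → Op n → (Fin n → Carrier) → Fin n → Set (c ⊔ ℓ₁)
  PreservesOut1 one f a j =
    (f (a [ j ≔ ⊥ ]) ≈ ⊥) ×
    (∀ b d → f (a [ j ≔ b ∨ d ]) ≈ f (a [ j ≔ b ]) ∨ f (a [ j ≔ d ]))
  PreservesOut1 ∂ f a j =
    (f (a [ j ≔ ⊤ ]) ≈ ⊥) ×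
    (∀ b d → f (a [ j ≔ b ∧ d ]) ≈ f (a [ j ≔ b ]) ∨ f (a [ j ≔ d ]))

  PreservesOut∂ : ∀ {n} → Ty → Op n → (Fin n → Carrier) → Fin n → Set (c ⊔ ℓ₁)
  PreservesOut∂ ∂ h a j =
    (h (a [ j ≔ ⊤ ]) ≈ ⊤) ×
    (∀ b d → h (a [ j ≔ b ∧ d ]) ≈ h (a [ j ≔ b ]) ∧ h (a [ j ≔ d ]))
  PreservesOut∂ one h a j =
    (h (a [ j ≔ ⊥ ]) ≈ ⊤) ×
    (∀ b d → h (a [ j ≔ b ∨ d ]) ≈ h (a [ j ≔ b ]) ∧ h (a [ j ≔ d ]))

  Congruent : ∀ {n} → Op n → Set (c ⊔ ℓ₁)
  Congruent f = ∀ a b → (∀ j → a j ≈ b j) → f a ≈ f b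

  record IsNormalOut1 {n} (i : Fin n → Ty) (f : Op n) : Set (c ⊔ ℓ₁) where
    field
      cong      : Congruent f
      preserves : ∀ j a → PreservesOut1 (i j) f a j

  record IsNormalOut∂ {n} (t : Fin n → Ty) (h : Op n) : Set (c ⊔ ℓ₁) where
    field
      cong      : Congruent h
      preserves : ∀ j a → PreservesOut∂ (t j) h a j

  -- filters and ideals (all of them, including the improper ones)
  record IsFilter (x : Pred Carrier ℓ) : Set ℓ where
    field
      top  : x ⊤
      up   : ∀ {a b} → a ≤ b → x a → x b
      meet : ∀ {a b} → x a → x b → x (a ∧ b)

  record IsIdeal (y : Pred Carrier ℓ) : Set ℓ where
    field
      bot  : y ⊥
      down : ∀ {a b} → b ≤ a → y a → y b
      join : ∀ {a b} → y a → y b → y (a ∨ b)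

  Filter : Set (lsuc ℓ)
  Filter = Σ (Pred Carrier ℓ) IsFilter

  Ideal : Set (lsuc ℓ)
  Ideal = Σ (Pred Carrier ℓ) IsIdeal

  Z : Ty → Set (lsuc ℓ)
  Z one = Filter
  Z ∂   = Ideal

  mem : (s : Ty) → Z s → Pred Carrier ℓ
  mem one x = proj₁ x
  mem ∂   y = proj₁ y

  GenFilter : Pred Carrier ℓ → Pred Carrier ℓ
  GenFilter S b = Σ ℕ λ m → Σ (Fin m → Carrier) λ g →
                    (∀ k → S (g k)) × (meetF m g ≤ b)

  GenIdeal : Pred Carrier ℓ → Pred Carrier ℓ
  GenIdeal S b = Σ ℕ λ m → Σ (Fin m → Carrier) λ g →
                   (∀ k → S (g k)) × (b ≤ joinF m g)

  _I_ : Filter → Ideal → Set ℓ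
  x I y = ∃ λ a → proj₁ x a × proj₁ y a

  SX : Set (lsuc (lsuc ℓ))
  SX = Pred Filter (lsuc ℓ)

  SY : Set (lsuc (lsuc ℓ))
  SY = Pred Ideal (lsuc ℓ)

  SZ : Ty → Set (lsuc (lsuc ℓ))
  SZ s = Pred (Z s) (lsuc ℓ)

  _⊥' : SX → SY
  (U ⊥') y = ∀ {x} → U x → x I y

  ⊥'_ : SY → SX
  (⊥' V) x = ∀ {y} → V y → x I y

  Stable : SX → Set (lsuc ℓ)
  Stable A = ⊥' (A ⊥') ⊆ A

  CoStable : SY → Set (lsuc ℓ)
  CoStable B = (⊥' B) ⊥' ⊆ B

  ζ₁ : Carrier → SX
  ζ₁ a x = Lift (lsuc ℓ) (proj₁ x a)

  ζ∂ : Carrier → SY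
  ζ∂ a y = Lift (lsuc ℓ) (proj₁ y a)

  ⋀ : {J : Set (lsuc ℓ)} → (J → SX) → SX
  ⋀ F x = ∀ j → F j x

  ⋁ : {J : Set (lsuc ℓ)} → (J → SX) → SX
  ⋁ F = ⊥' ((λ x → ∃ λ j → F j x) ⊥')

  module _ {n : ℕ} where

    f̂ : (i : Fin n → Ty) → Op n → ((j : Fin n) → Z (i j)) → Pred Carrier ℓ
    f̂ i f u = GenFilter (λ b → ∃ λ a → (∀ j → mem (i j) (u j) (a j)) × (f a ≈ b))

    ĥ : (t : Fin n → Ty) → Op n → ((j : Fin n) → Z (t j)) → Pred Carrier ℓ
    ĥ t h v = GenIdeal (λ b → ∃ λ a → (∀ j → mem (t j) (v j) (a j)) × (h a ≈ b))

    Rrel : (i : Fin n → Ty) → Op n → Filter → ((j : Fin n) → Z (i j)) → Set ℓ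
    Rrel i f x u = f̂ i f u ⊆ proj₁ x

    Srel : (t : Fin n → Ty) → Op n → Ideal → ((j : Fin n) → Z (t j)) → Set ℓ
    Srel t h y v = ĥ t h v ⊆ proj₁ y

    αR : (i : Fin n → Ty) → Op n → ((j : Fin n) → SZ (i j)) → SX
    αR i f F = ⊥' ((λ x → ∃ λ u → (∀ j → F j (u j)) × Rrel i f x u) ⊥')

    ηS : (t : Fin n → Ty) → Op n → ((j : Fin n) → SZ (t j)) → SY
    ηS t h G = (⊥' (λ y → ∃ λ v → (∀ j → G j (v j)) × Srel t h y v)) ⊥'

    argX : (s : Ty) → SX → SZ s
    argX one A = A
    argX ∂   A = A ⊥'

    argY : (s : Ty) → SY → SZ s
    argY one B = ⊥' B
    argY ∂   B = B

    αf : (i : Fin n → Ty) → Op n → (Fin n → SX) → SX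
    αf i f A = αR i f (λ j → argX (i j) (A j))

    ηh : (t : Fin n → Ty) → Op n → (Fin n → SY) → SY
    ηh t h B = ηS t h (λ j → argY (t j) (B j))

    ηhX : (t : Fin n → Ty) → Op n → (Fin n → SX) → SX
    ηhX t h A = ⊥' (ηh t h (λ j → A j ⊥'))

  -- σ- and π-extensions in the canonical extension 𝒢(X)
  -- closed elements Γx (x a filter), open elements ^⊥{y} (y an ideal)
  Γ : Filter → SX
  Γ x x' = Lift (lsuc ℓ) (proj₁ x ⊆ proj₁ x')

  ⊥⟨_⟩ : Ideal → SX
  ⊥⟨ y ⟩ x = Lift (lsuc ℓ) (x I y)

  elemZ : (s : Ty) → Z s → SX
  elemZ one x = Γ x
  elemZ ∂   y = ⊥⟨ y ⟩

  Leq : Ty → SX → SX → Set (lsuc ℓ)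
  Leq one A B = A ⊆ B
  Leq ∂   A B = B ⊆ A

  module _ {n : ℕ} where

    -- σ-extension of f : L^ε → L (ε = i).  Closed elements of 𝒢(X)^ε
    -- are tuples with Γxⱼ (εⱼ = 1) resp. ^⊥{yⱼ} (εⱼ = ∂).
    fσClosed : (i : Fin n → Ty) → Op n → ((j : Fin n) → Z (i j)) → SX
    fσClosed i f k =
      ⋀ {J = Σ (Fin n → Carrier) λ a → ∀ j → Leq (i j) (elemZ (i j) (k j)) (ζ₁ (a j))}
        (λ p → ζ₁ (f (proj₁ p)))

    fσ : (i : Fin n → Ty) → Op n → (Fin n → SX) → SX
    fσ i f A =
      ⋁ {J = Σ ((j : Fin n) → Z (i j)) λ k → ∀ j → Leq (i j) (elemZ (i j) (k j)) (A j)}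
        (λ p → fσClosed i f (proj₁ p))

    -- π-extension of h : L^ε → L with εⱼ = dual tⱼ.  Open elements of
    -- 𝒢(X)^ε are tuples with ^⊥{yⱼ} (tⱼ = ∂) resp. Γxⱼ (tⱼ = 1).
    hπOpen : (t : Fin n → Ty) → Op n → ((j : Fin n) → Z (t j)) → SX
    hπOpen t h o =
      ⋁ {J = Σ (Fin n → Carrier) λ a → ∀ j → Leq (dual (t j)) (ζ₁ (a j)) (elemZ (t j) (o j))}
        (λ p → ζ₁ (h (proj₁ p)))

    hπ : (t : Fin n → Ty) → Op n → (Fin n → SX) → SX
    hπ t h A =
      ⋀ {J = Σ ((j : Fin n) → Z (t j)) λ o → ∀ j → Leq (dual (t j)) (A j) (elemZ (t j) (o j))}
        (λ p → hπOpen t h (proj₁ p))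

-- For a closed tuple u (filters in the 1-places, ideals in the ∂-places), x R u says that
-- f̂(u) ⊆ x, i.e. that f(a) ∈ x whenever a lies above u in the canonical order; so R u is
-- exactly the value of the σ-extension at u. Since the closed tuples below a tuple of Galois
-- sets A are precisely the tuples of the argument sets of ᾱ_f, closing the union of the R u
-- gives the join of the σ-extension over closed elements below A. Dually y S v says that
-- h(a) ∈ y whenever a lies below the open tuple v, so the π-extension at v is ^⊥{y ∣ y S v},
-- and the meet of these over open tuples above A is ^⊥ of the union of the S v, which is
-- the Galois image of η̄_h(A').
module Submission where

open import Defs
open import Level using (Level; Lift; lift; lower)
open import Data.Nat using (ℕ; zero; suc)
open import Data.Fin using (Fin; zero; suc)
open import Data.Product using (_×_; _,_; proj₁; proj₂; Σ; ∃)
open import Relation.Unary using (Pred; _≐_; _⊆_)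
open import Relation.Unary.Properties using (≐-sym; ≐-trans)
open import Relation.Binary.Lattice.Bundles using (BoundedLattice)

module _ {c ℓ₁ ℓ₂ : Level} (𝓛 : BoundedLattice c ℓ₁ ℓ₂) where
  open Canonical 𝓛
  open BoundedLattice 𝓛
    using (Carrier; _≈_; _≤_; ⊤; ⊥; refl; trans; reflexive; maximum;
           ∧-greatest; x∧y≤x; x≤x∨y; module Eq)

  principal : Carrier → Filter
  principal a = (λ b → Lift ℓ (a ≤ b)) , record
    { top  = lift (maximum a)
    ; up   = λ a≤b a≤c → lift (trans (lower a≤c) a≤b)
    ; meet = λ a≤b a≤c → lift (∧-greatest (lower a≤b) (lower a≤c))
    }

  module _ (x : Filter) where
    open IsFilter (proj₂ x)

    meetF-closed : ∀ m (g : Fin m → Carrier) → (∀ k → proj₁ x (g k)) → proj₁ x (meetF m g)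
    meetF-closed zero    g g∈x = top
    meetF-closed (suc m) g g∈x =
      meet (g∈x zero) (meetF-closed m (λ k → g (suc k)) (λ k → g∈x (suc k)))

    GenFilter-least : (S : Pred Carrier ℓ) → S ⊆ proj₁ x → GenFilter S ⊆ proj₁ x
    GenFilter-least S S⊆x (m , g , g∈S , ⋀g≤b) = up ⋀g≤b (meetF-closed m g (λ k → S⊆x (g∈S k)))

  module _ (y : Ideal) where
    open IsIdeal (proj₂ y)

    joinF-closed : ∀ m (g : Fin m → Carrier) → (∀ k → proj₁ y (g k)) → proj₁ y (joinF m g)
    joinF-closed zero    g g∈y = bot
    joinF-closed (suc m) g g∈y =
      join (g∈y zero) (joinF-closed m (λ k → g (suc k)) (λ k → g∈y (suc k)))

    GenIdeal-least : (S : Pred Carrier ℓ) → S ⊆ proj₁ y → GenIdeal S ⊆ proj₁ y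
    GenIdeal-least S S⊆y (m , g , g∈S , b≤⋁g) = down b≤⋁g (joinF-closed m g (λ k → S⊆y (g∈S k)))

  GenFilter-generator : (S : Pred Carrier ℓ) → S ⊆ GenFilter S
  GenFilter-generator S {b} b∈S = 1 , (λ _ → b) , (λ _ → b∈S) , x∧y≤x b ⊤

  GenIdeal-generator : (S : Pred Carrier ℓ) → S ⊆ GenIdeal S
  GenIdeal-generator S {b} b∈S = 1 , (λ _ → b) , (λ _ → b∈S) , x≤x∨y b ⊥

  closure-mono : (U V : SX) → U ⊆ V → ⊥' (U ⊥') ⊆ ⊥' (V ⊥')
  closure-mono U V U⊆V x∈U'' {y} y∈V' = x∈U'' {y} (λ {x'} x'∈U → y∈V' {x'} (U⊆V x'∈U))

  closure-cong : (U V : SX) → U ≐ V → ⊥' (U ⊥') ≐ ⊥' (V ⊥')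
  closure-cong U V (U⊆V , V⊆U) =
    (λ {x} → closure-mono U V U⊆V {x}) , (λ {x} → closure-mono V U V⊆U {x})

  ⊥'-closed : (V : SY) → ⊥' ((⊥' V) ⊥') ≐ ⊥' V
  ⊥'-closed V = (λ x∈V''' {y} y∈V → x∈V''' {y} (λ x'∈⊥V → x'∈⊥V y∈V))
              , (λ {x} x∈⊥V {y} y∈V'' → y∈V'' {x} x∈⊥V)

  Stable-up : {A : SX} → Stable A → {x x' : Filter} → A x → proj₁ x ⊆ proj₁ x' → A x'
  Stable-up stable x∈A x⊆x' = stable λ y∈A' →
    let (b , b∈x , b∈y) = y∈A' x∈A in b , x⊆x' b∈x , b∈y

  mem⇒elemZ≤ζ₁ : ∀ s (k : Z s) {a} → mem s k a → Leq s (elemZ s k) (ζ₁ a)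
  mem⇒elemZ≤ζ₁ one k a∈k k⊆x       = lift (lower k⊆x a∈k)
  mem⇒elemZ≤ζ₁ ∂   k a∈k {x} a∈x = lift (_ , lower a∈x , a∈k)

  elemZ≤ζ₁⇒mem : ∀ s (k : Z s) {a} → Leq s (elemZ s k) (ζ₁ a) → mem s k a
  elemZ≤ζ₁⇒mem one k Γk⊆ζa = lower (Γk⊆ζa {k} (lift λ b∈k → b∈k))
  elemZ≤ζ₁⇒mem ∂   k {a} ζa⊆k =
    let (b , lift a≤b , b∈k) = lower (ζa⊆k {principal a} (lift (lift refl)))
    in IsIdeal.down (proj₂ k) a≤b b∈k

  Leq-dual⁺ : ∀ s {A B : SX} → Leq s B A → Leq (dual s) A B
  Leq-dual⁺ one B⊆A = B⊆A
  Leq-dual⁺ ∂   A⊆B = A⊆B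

  Leq-dual⁻ : ∀ s {A B : SX} → Leq (dual s) A B → Leq s B A
  Leq-dual⁻ one B⊆A = B⊆A
  Leq-dual⁻ ∂   A⊆B = A⊆B

  module _ {n : ℕ} {A : SX} where

    argX⇒elemZ≤ : Stable A → ∀ s (k : Z s) → argX {n} s A k → Leq s (elemZ s k) A
    argX⇒elemZ≤ stable one k k∈A k⊆x = Stable-up stable k∈A (lower k⊆x)
    argX⇒elemZ≤ stable ∂   k k∈A' x∈A = lift (k∈A' x∈A)

    elemZ≤⇒argX : ∀ s (k : Z s) → Leq s (elemZ s k) A → argX {n} s A k
    elemZ≤⇒argX one k Γk⊆A = Γk⊆A {k} (lift λ b∈k → b∈k)
    elemZ≤⇒argX ∂   k A⊆k x∈A = lower (A⊆k x∈A)

    argY⇒≤elemZ : Stable A → ∀ s (o : Z s) → argY {n} s (A ⊥') o → Leq (dual s) A (elemZ s o)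
    argY⇒≤elemZ stable one o o∈A'' {x} o⊆x = stable {x} λ {y} y∈A' →
      let (b , b∈o , b∈y) = o∈A'' {y} y∈A' in b , lower o⊆x b∈o , b∈y
    argY⇒≤elemZ stable ∂   o o∈A' x∈A = lift (o∈A' x∈A)

    ≤elemZ⇒argY : ∀ s (o : Z s) → Leq (dual s) A (elemZ s o) → argY {n} s (A ⊥') o
    ≤elemZ⇒argY one o Γo⊆A y∈A' = y∈A' (Γo⊆A {o} (lift λ b∈o → b∈o))
    ≤elemZ⇒argY ∂   o A⊆o x∈A = lower (A⊆o x∈A)

  module _ {n : ℕ} where

    image : (s : Fin n → Ty) → Op n → ((j : Fin n) → Z (s j)) → Pred Carrier ℓ
    image s f u b = ∃ λ a → (∀ j → mem (s j) (u j) (a j)) × (f a ≈ b)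

    Rrel⇒fσClosed : (i : Fin n → Ty) (f : Op n) (x : Filter) (u : (j : Fin n) → Z (i j)) →
                    Rrel i f x u → fσClosed i f u x
    Rrel⇒fσClosed i f x u f̂u⊆x (a , u≤a) =
      lift (f̂u⊆x (GenFilter-generator (image i f u)
                    (a , (λ j → elemZ≤ζ₁⇒mem (i j) (u j) (u≤a j)) , Eq.refl)))

    fσClosed⇒Rrel : (i : Fin n → Ty) (f : Op n) (x : Filter) (u : (j : Fin n) → Z (i j)) →
                    fσClosed i f u x → Rrel i f x u
    fσClosed⇒Rrel i f x u fσu∋x = GenFilter-least x (image i f u) λ (a , a∈u , fa≈b) →
      IsFilter.up (proj₂ x) (reflexive fa≈b)
        (lower (fσu∋x (a , λ j → mem⇒elemZ≤ζ₁ (i j) (u j) (a∈u j))))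

    -- hπOpen t h o is the Galois closure of this set
    hπOpenGenerators : (t : Fin n → Ty) → Op n → ((j : Fin n) → Z (t j)) → SX
    hπOpenGenerators t h o x =
      ∃ λ (p : Σ (Fin n → Carrier) λ a → ∀ j → Leq (dual (t j)) (ζ₁ (a j)) (elemZ (t j) (o j))) →
        ζ₁ (h (proj₁ p)) x

    Srel⇒hπOpenGenerators⊥ : (t : Fin n → Ty) (h : Op n) (y : Ideal) (o : (j : Fin n) → Z (t j)) →
                             Srel t h y o → (hπOpenGenerators t h o ⊥') y
    Srel⇒hπOpenGenerators⊥ t h y o ĥo⊆y ((a , a≤o) , lift ha∈x) =
      h a , ha∈x ,
      ĥo⊆y (GenIdeal-generator (image t h o)
              (a , (λ j → elemZ≤ζ₁⇒mem (t j) (o j) (Leq-dual⁻ (t j) (a≤o j))) , Eq.refl))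

    hπOpenGenerators⊥⇒Srel : (t : Fin n → Ty) (h : Op n) (y : Ideal) (o : (j : Fin n) → Z (t j)) →
                             (hπOpenGenerators t h o ⊥') y → Srel t h y o
    hπOpenGenerators⊥⇒Srel t h y o gens⊆y = GenIdeal-least y (image t h o) λ (a , a∈o , ha≈b) →
      let a≤o j = Leq-dual⁺ (t j) (mem⇒elemZ≤ζ₁ (t j) (o j) (a∈o j))
          (_ , lift b≤c , c∈y) =
            gens⊆y {principal _} ((a , a≤o) , lift (lift (reflexive (Eq.sym ha≈b))))
      in IsIdeal.down (proj₂ y) b≤c c∈y

  module _ {n : ℕ} (A : Fin n → SX) (stable : ∀ j → Stable (A j)) where

    αf≐fσ : (i : Fin n → Ty) (f : Op n) → αf i f A ≐ fσ i f A
    αf≐fσ i f = closure-cong R[A] fσ[A]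
      ( (λ {x} (u , u∈A , xRu) →
          (u , λ j → argX⇒elemZ≤ {n} {A j} (stable j) (i j) (u j) (u∈A j)) ,
          Rrel⇒fσClosed i f x u xRu)
      , (λ {x} ((u , u≤A) , x∈fσu) →
          u , (λ j → elemZ≤⇒argX {n} {A j} (i j) (u j) (u≤A j)) , fσClosed⇒Rrel i f x u x∈fσu) )
      where
        R[A] : SX
        R[A] x = ∃ λ u → (∀ j → argX {n} (i j) (A j) (u j)) × Rrel i f x u

        fσ[A] : SX
        fσ[A] x =
          ∃ λ (p : Σ ((j : Fin n) → Z (i j)) λ u → ∀ j → Leq (i j) (elemZ (i j) (u j)) (A j)) →
            fσClosed i f (proj₁ p) x

    S[A] : (t : Fin n → Ty) → Op n → SY
    S[A] t h y = ∃ λ v → (∀ j → argY {n} (t j) (A j ⊥') (v j)) × Srel t h y v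

    hπ≐⊥S[A] : (t : Fin n → Ty) (h : Op n) → hπ t h A ≐ ⊥' (S[A] t h)
    hπ≐⊥S[A] t h = (λ {x} → hπ⊆⊥S[A] {x}) , (λ {x} → ⊥S[A]⊆hπ {x})
      where
        hπ⊆⊥S[A] : hπ t h A ⊆ ⊥' (S[A] t h)
        hπ⊆⊥S[A] {x} x∈hπ {y} (v , v∈A' , ySv) =
          x∈hπ (v , λ j → argY⇒≤elemZ {n} {A j} (stable j) (t j) (v j) (v∈A' j)) {y}
               (λ {x'} → Srel⇒hπOpenGenerators⊥ t h y v ySv {x'})

        ⊥S[A]⊆hπ : ⊥' (S[A] t h) ⊆ hπ t h A
        ⊥S[A]⊆hπ {x} x∈⊥S (o , A≤o) {y} gens⊆y =
          x∈⊥S {y} ( o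
                   , (λ j → ≤elemZ⇒argY {n} {A j} (t j) (o j) (A≤o j))
                   , hπOpenGenerators⊥⇒Srel t h y o (λ {x'} → gens⊆y {x'}))

    ηhX≐hπ : (t : Fin n → Ty) (h : Op n) → ηhX t h A ≐ hπ t h A
    ηhX≐hπ t h = ≐-trans (⊥'-closed (S[A] t h)) (≐-sym (hπ≐⊥S[A] t h))

-- The identities hold for arbitrary operations.
proposition3p8 : {c ℓ₁ ℓ₂ : Level} (𝓛 : BoundedLattice c ℓ₁ ℓ₂) (n : ℕ)
    (i t : Fin n → Ty) (f h : Canonical.Op 𝓛 n) →
    Canonical.IsNormalOut1 𝓛 i f → Canonical.IsNormalOut∂ 𝓛 t h →
    (A : Fin n → Canonical.SX 𝓛) → (∀ j → Canonical.Stable 𝓛 (A j)) →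
    (Canonical.αf 𝓛 i f A ≐ Canonical.fσ 𝓛 i f A) ×
    (Canonical.ηhX 𝓛 t h A ≐ Canonical.hπ 𝓛 t h A)
proposition3p8 𝓛 n i t f h _ _ A stable = αf≐fσ 𝓛 A stable i f , ηhX≐hπ 𝓛 A stable t h
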